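{- For $3\le n\le 2^d-1$, we have $\pi(d,n)>\pi(d,n+1)$.
   Context: Let $X_{d,n}$ be an $n$-element subset of $\{ -1,+1\}^d$ chosen uniformly at random, $P_{d,n}:=\operatorname{conv}X_{d,n}$, and $\{v,w\}$ a two-element subset of $X_{d,n}$ chosen uniformly at random. $\pi(d,n):=\Pr[\{v,w\}\text{ is an edge (one-dimensional face) of }P_{d,n}]$. -}

module Defs where

open import Data.Nat as ℕ using (ℕ; zero; suc; _^_)
open import Data.Nat.Combinatorics using (_C_)
open import Data.Integer using (+_)
open import Data.Rational as ℚ using (ℚ; 0ℚ; 1ℚ; -_; _+_; _*_; _<_; _/_)
open import Data.List using (List; []; _∷_; map; _++_; [_])
open import Data.Nat.ListAction using (sum)
open import Data.List.Relation.Unary.All using (All)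
open import Data.Vec using (Vec; []; _∷_)
open import Data.Product using (Σ; _×_)
open import Data.Sum using (_⊎_)
open import Relation.Binary.PropositionalEquality using (_≡_)
open import Relation.Nullary using (Dec; does)
open import Data.Bool using (if_then_else_)

Point : ℕ → Set
Point d = Vec ℚ d

cube : (d : ℕ) → List (Point d)
cube zero    = [ [] ]
cube (suc d) = map (1ℚ ∷_) (cube d) ++ map ((- 1ℚ) ∷_) (cube d)

-- All k-element sublists (= k-subsets, for duplicate-free lists), each once.
choose : {A : Set} → ℕ → List A → List (List A)
choose zero    _        = [ [] ]
choose (suc k) []       = []
choose (suc k) (x ∷ xs) = map (x ∷_) (choose k xs) ++ choose (suc k) xs

dot : {d : ℕ} → Point d → Point d → ℚ
dot []       []       = 0ℚ
dot (a ∷ as) (x ∷ xs) = a * x + dot as xs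

-- {v,w} is an edge of conv X (X a set of cube vertices, hence in convex
-- position): some linear inequality ⟨a,x⟩ ≤ b is valid on X and is tight
-- exactly at v and w (the face cut out is the segment conv{v,w}).
IsEdge : {d : ℕ} → List (Point d) → Point d → Point d → Set
IsEdge {d} X v w =
  Σ (Point d) λ a → Σ ℚ λ b →
    dot a v ≡ b × dot a w ≡ b ×
    All (λ x → x ≡ v ⊎ (x ≡ w ⊎ dot a x < b)) X

-- A decision procedure for IsEdge (any two give the same counts).
EdgeDecider : ℕ → Set
EdgeDecider d = (X : List (Point d)) (v w : Point d) → Dec (IsEdge X v w)

edgeIndicator : {d : ℕ} → EdgeDecider d → List (Point d) → List (Point d) → ℕ
edgeIndicator dec X (v ∷ w ∷ []) = if does (dec X v w) then 1 else 0
edgeIndicator dec X _            = 0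

edgeCount : (d : ℕ) → EdgeDecider d → ℕ → ℕ
edgeCount d dec n =
  sum (map (λ X → sum (map (edgeIndicator dec X) (choose 2 X))) (choose n (cube d)))

-- Total number of equally likely outcomes (X, {v,w}).
outcomes : ℕ → ℕ → ℕ
outcomes d n = ((2 ^ d) C n) ℕ.* (n C 2)

-- π(d,n) (convention: 0 when there are no outcomes, i.e. n < 2 or n > 2^d).
π : (d : ℕ) → EdgeDecider d → ℕ → ℚ
π d dec n with outcomes d n
... | zero  = 0ℚ
... | suc k = (+ edgeCount d dec n) / suc k

{-# OPTIONS --safe #-}
-- Write N = 2^d, E(n) = edgeCount d dec n and edges(X) for the number of edges of conv X.
-- Summing edges(Z) over all pairs Z ⊂ Y with |Y| = n + 1, |Z| = n gives (N − n) E(n), since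
-- each n-set has N − n supersets.  An edge of conv Y with both ends in Z ⊂ Y is still an edge
-- of conv Z, and each pair of Y lies in n − 1 of the sets Z, so (n − 1) edges(Y) ≤ Σ_Z edges(Z)
-- and hence (n − 1) E(n+1) ≤ (N − n) E(n).  Strictness comes from any Y containing a square
-- face {v₊₊, v₊₋, v₋₊, v₋₋} of the cube: the diagonal {v₊₊, v₋₋} is not an edge of conv Y,
-- as v₊₊ + v₋₋ = v₊₋ + v₋₊, but becomes one once v₊₋ is deleted.  With the binomial identities
-- (n + 1) C(N, n+1) = (N − n) C(N, n) and (n − 1) C(n+1, 2) = (n + 1) C(n, 2), the strict
-- inequality (n − 1) E(n+1) < (N − n) E(n) is π(d, n+1) < π(d, n) with denominators cleared.
module Submission where

open import Defs

module Counting where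

  open import Data.Nat
    using (ℕ; zero; suc; _+_; _*_; _^_; _≤_; _<_; _>_; z≤n; s≤s; NonZero; >-nonZero)
  open import Data.Nat.Properties
  open import Data.Nat.Combinatorics using (_C_; nCk+nC[k+1]≡[n+1]C[k+1]; nC1≡n)
  open import Data.Nat.ListAction using (sum)
  open import Data.Nat.ListAction.Properties using (sum-++)
  open import Data.Nat.Tactic.RingSolver using (solve-∀)
  open import Algebra.Properties.CommutativeSemigroup +-commutativeSemigroup
    using (xy∙z≈xz∙y) renaming (interchange to +-interchange)
  open import Data.List using (List; []; _∷_; map; _++_; [_]; length; take; replicate)
  open import Data.List.Properties
    using (length-++; length-map; map-++; map-∘; map-cong; length-replicate)
  open import Data.List.Relation.Unary.All as All using (All; []; _∷_)
  open import Data.List.Relation.Unary.All.Properties as All using ()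
  open import Data.List.Relation.Unary.Any using (here; there)
  open import Data.List.Membership.Propositional using (_∈_)
  open import Data.List.Membership.Propositional.Properties using (∈-++⁺ˡ; ∈-++⁺ʳ; ∈-map⁺)
  open import Data.List.Relation.Binary.Subset.Propositional using (_⊆_)
  open import Data.Unit using (tt)
  open import Data.Vec using (_∷_)
  open import Data.Rational using (1ℚ; -_)
  open import Data.Product using (_,_)
  open import Relation.Nullary using (¬_; yes; no; contradiction)
  open import Relation.Binary.PropositionalEquality
    using (_≡_; refl; sym; trans; cong; cong₂; subst; module ≡-Reasoning)

  private
    variable
      A B : Set

  ∑ : List A → (A → ℕ) → ℕ
  ∑ xs f = sum (map f xs)

  syntax ∑ xs (λ x → e) = ∑[ x ← xs ] e

  ∑-++ : ∀ xs ys (f : A → ℕ) → ∑ (xs ++ ys) f ≡ ∑ xs f + ∑ ys f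
  ∑-++ xs ys f = trans (cong sum (map-++ f xs ys)) (sum-++ (map f xs) (map f ys))

  ∑-map : ∀ (g : A → B) xs (f : B → ℕ) → ∑ (map g xs) f ≡ ∑[ x ← xs ] f (g x)
  ∑-map g xs f = cong sum (sym (map-∘ xs))

  ∑-cong : ∀ {f g : A → ℕ} → (∀ x → f x ≡ g x) → ∀ xs → ∑ xs f ≡ ∑ xs g
  ∑-cong f≗g xs = cong sum (map-cong f≗g xs)

  ∑-+ : ∀ xs (f g : A → ℕ) → ∑[ x ← xs ] (f x + g x) ≡ ∑ xs f + ∑ xs g
  ∑-+ []       f g = refl
  ∑-+ (x ∷ xs) f g = trans (cong (f x + g x +_) (∑-+ xs f g)) (+-interchange (f x) (g x) _ _)

  ∑-*ˡ : ∀ k xs (f : A → ℕ) → ∑[ x ← xs ] (k * f x) ≡ k * ∑ xs f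
  ∑-*ˡ k []       f = sym (*-zeroʳ k)
  ∑-*ˡ k (x ∷ xs) f = trans (cong (k * f x +_) (∑-*ˡ k xs f)) (sym (*-distribˡ-+ k (f x) _))

  ∑-const : ∀ c (xs : List A) → ∑[ _ ← xs ] c ≡ c * length xs
  ∑-const c []       = sym (*-zeroʳ c)
  ∑-const c (x ∷ xs) = trans (cong (c +_) (∑-const c xs)) (sym (*-suc c (length xs)))

  ∑-1 : ∀ (xs : List A) → ∑[ _ ← xs ] 1 ≡ length xs
  ∑-1 xs = trans (∑-const 1 xs) (*-identityˡ (length xs))

  ∑-cong-All : ∀ {f g : A → ℕ} xs → All (λ x → f x ≡ g x) xs → ∑ xs f ≡ ∑ xs g
  ∑-cong-All []       []            = refl
  ∑-cong-All (x ∷ xs) (fx≡gx ∷ eqs) = cong₂ _+_ fx≡gx (∑-cong-All xs eqs)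

  ∑-mono-≤ : ∀ {f g : A → ℕ} xs → All (λ x → f x ≤ g x) xs → ∑ xs f ≤ ∑ xs g
  ∑-mono-≤ []       []            = z≤n
  ∑-mono-≤ (x ∷ xs) (fx≤gx ∷ les) = +-mono-≤ fx≤gx (∑-mono-≤ xs les)

  ∑-mono-< : ∀ {f g : A → ℕ} xs → All (λ x → f x ≤ g x) xs →
             ∀ {y} → y ∈ xs → f y < g y → ∑ xs f < ∑ xs g
  ∑-mono-< (x ∷ xs) (_ ∷ les)     (here refl) fy<gy = +-mono-<-≤ fy<gy (∑-mono-≤ xs les)
  ∑-mono-< (x ∷ xs) (fx≤gx ∷ les) (there y∈)  fy<gy =
    +-mono-≤-< fx≤gx (∑-mono-< xs les y∈ fy<gy)

  deletions : List A → List (List A)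
  deletions []       = []
  deletions (x ∷ xs) = map (x ∷_) (deletions xs) ++ [ xs ]

  length-deletions : ∀ (xs : List A) → length (deletions xs) ≡ length xs
  length-deletions []       = refl
  length-deletions (x ∷ xs) = begin
    length (map (x ∷_) (deletions xs) ++ [ xs ]) ≡⟨ length-++ (map (x ∷_) (deletions xs)) ⟩
    length (map (x ∷_) (deletions xs)) + 1       ≡⟨ cong (_+ 1) (length-map (x ∷_) (deletions xs)) ⟩
    length (deletions xs) + 1                    ≡⟨ cong (_+ 1) (length-deletions xs) ⟩
    length xs + 1                                ≡⟨ +-comm (length xs) 1 ⟩
    suc (length xs)                              ∎
    where open ≡-Reasoning

  deletions-⊆ : ∀ (xs : List A) → All (_⊆ xs) (deletions xs)
  deletions-⊆ []       = []
  deletions-⊆ (x ∷ xs) = All.++⁺ (All.map⁺ (All.map ∷⁺ (deletions-⊆ xs))) (there ∷ [])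
    where
      ∷⁺ : ∀ {ys} → ys ⊆ xs → (x ∷ ys) ⊆ (x ∷ xs)
      ∷⁺ ys⊆xs (here y≡x) = here y≡x
      ∷⁺ ys⊆xs (there y∈) = there (ys⊆xs y∈)

  x∷xs∈deletions[x∷y∷xs] : ∀ (x y : A) xs → (x ∷ xs) ∈ deletions (x ∷ y ∷ xs)
  x∷xs∈deletions[x∷y∷xs] x y xs =
    ∈-++⁺ˡ (∈-map⁺ (x ∷_) (∈-++⁺ʳ (map (y ∷_) (deletions xs)) (here refl)))

  length-choose : ∀ k (xs : List A) → length (choose k xs) ≡ length xs C k
  length-choose zero    xs       = refl
  length-choose (suc k) []       = refl
  length-choose (suc k) (x ∷ xs) = begin
    length (map (x ∷_) (choose k xs) ++ choose (suc k) xs)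
      ≡⟨ length-++ (map (x ∷_) (choose k xs)) ⟩
    length (map (x ∷_) (choose k xs)) + length (choose (suc k) xs)
      ≡⟨ cong₂ _+_ (trans (length-map (x ∷_) (choose k xs)) (length-choose k xs))
                   (length-choose (suc k) xs) ⟩
    length xs C k + length xs C suc k
      ≡⟨ nCk+nC[k+1]≡[n+1]C[k+1] (length xs) k ⟩
    suc (length xs) C suc k
      ∎
    where open ≡-Reasoning

  choose-length : ∀ k (xs : List A) → All (λ ys → length ys ≡ k) (choose k xs)
  choose-length zero    xs       = refl ∷ []
  choose-length (suc k) []       = []
  choose-length (suc k) (x ∷ xs) =
    All.++⁺ (All.map⁺ (All.map (cong suc) (choose-length k xs))) (choose-length (suc k) xs)

  take∈choose : ∀ k (xs : List A) → k ≤ length xs → take k xs ∈ choose k xs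
  take∈choose zero    xs       _         = here refl
  take∈choose (suc k) (x ∷ xs) (s≤s k≤n) = ∈-++⁺ˡ (∈-map⁺ (x ∷_) (take∈choose k xs k≤n))

  ∑-deletions-∷ : ∀ x xs (f : List A → ℕ) →
                  ∑ (deletions (x ∷ xs)) f ≡ ∑[ ys ← deletions xs ] f (x ∷ ys) + f xs
  ∑-deletions-∷ x xs f = begin
    ∑ (map (x ∷_) (deletions xs) ++ [ xs ]) f
      ≡⟨ ∑-++ (map (x ∷_) (deletions xs)) [ xs ] f ⟩
    ∑ (map (x ∷_) (deletions xs)) f + (f xs + 0)
      ≡⟨ cong₂ _+_ (∑-map (x ∷_) (deletions xs) f) (+-identityʳ (f xs)) ⟩
    ∑[ ys ← deletions xs ] f (x ∷ ys) + f xs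
      ∎
    where open ≡-Reasoning

  ∑-choose-∷ : ∀ k x xs (f : List A → ℕ) →
    ∑ (choose (suc k) (x ∷ xs)) f ≡ ∑[ ys ← choose k xs ] f (x ∷ ys) + ∑ (choose (suc k) xs) f
  ∑-choose-∷ k x xs f = trans (∑-++ (map (x ∷_) (choose k xs)) (choose (suc k) xs) f)
                              (cong (_+ ∑ (choose (suc k) xs) f) (∑-map (x ∷_) (choose k xs) f))

  private
    double-counting-step : ∀ n j {A₁ A₃ P Q} → A₁ + j * P ≡ n * P → A₃ + suc j * Q ≡ n * Q →
      A₁ + A₃ + Q + suc j * (P + Q) ≡ suc n * (P + Q)
    double-counting-step n j {A₁} {A₃} {P} {Q} eq₁ eq₃ = begin
      A₁ + A₃ + Q + suc j * (P + Q)             ≡⟨ regroup A₁ A₃ Q j P ⟩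
      (A₁ + j * P) + (A₃ + suc j * Q) + (P + Q) ≡⟨ cong₂ (λ u v → u + v + (P + Q)) eq₁ eq₃ ⟩
      n * P + n * Q + (P + Q)                   ≡⟨ collect n P Q ⟩
      suc n * (P + Q)                           ∎
      where
        open ≡-Reasoning
        regroup : ∀ A₁ A₃ Q j P →
          A₁ + A₃ + Q + suc j * (P + Q) ≡ (A₁ + j * P) + (A₃ + suc j * Q) + (P + Q)
        regroup = solve-∀
        collect : ∀ n P Q → n * P + n * Q + (P + Q) ≡ suc n * (P + Q)
        collect = solve-∀

  -- A k-subset of xs is a deletion of exactly (length xs − k) of the (k+1)-subsets of xs;
  -- k is moved to the left to avoid truncated subtraction.
  ∑-choose-deletions : ∀ k (xs : List A) (f : List A → ℕ) →
    ∑[ ys ← choose (suc k) xs ] ∑ (deletions ys) f + k * ∑ (choose k xs) f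
      ≡ length xs * ∑ (choose k xs) f
  ∑-choose-deletions zero    []       f = refl
  ∑-choose-deletions (suc k) []       f = *-zeroʳ (suc k)
  ∑-choose-deletions zero    (x ∷ xs) f =
    trans (+-assoc (f [] + 0) _ 0) (cong (f [] + 0 +_) (∑-choose-deletions zero xs f))
  ∑-choose-deletions (suc j) (x ∷ xs) f = begin
    ∑[ ys ← choose (suc (suc j)) (x ∷ xs) ] ∑ (deletions ys) f
      + suc j * ∑ (choose (suc j) (x ∷ xs)) f
      ≡⟨ cong₂ (λ u v → u + suc j * v) outer (∑-choose-∷ j x xs f) ⟩
    A₁ + A₃ + Q + suc j * (P + Q)
      ≡⟨ double-counting-step (length xs) j
           (∑-choose-deletions j xs f′) (∑-choose-deletions (suc j) xs f) ⟩
    suc (length xs) * (P + Q)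
      ≡⟨ cong (suc (length xs) *_) (∑-choose-∷ j x xs f) ⟨
    suc (length xs) * ∑ (choose (suc j) (x ∷ xs)) f
      ∎
    where
      open ≡-Reasoning
      f′ = λ ys → f (x ∷ ys)
      A₁ = ∑[ ys ← choose (suc j) xs ] ∑ (deletions ys) f′
      A₃ = ∑[ ys ← choose (suc (suc j)) xs ] ∑ (deletions ys) f
      P  = ∑ (choose j xs) f′
      Q  = ∑ (choose (suc j) xs) f
      outer : ∑[ ys ← choose (suc (suc j)) (x ∷ xs) ] ∑ (deletions ys) f ≡ A₁ + A₃ + Q
      outer = begin
        ∑[ ys ← choose (suc (suc j)) (x ∷ xs) ] ∑ (deletions ys) f
          ≡⟨ ∑-choose-∷ (suc j) x xs (λ ys → ∑ (deletions ys) f) ⟩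
        ∑[ ys ← choose (suc j) xs ] ∑ (deletions (x ∷ ys)) f + A₃
          ≡⟨ cong (_+ A₃) (∑-cong (λ ys → ∑-deletions-∷ x ys f) (choose (suc j) xs)) ⟩
        ∑[ ys ← choose (suc j) xs ] (∑ (deletions ys) f′ + f ys) + A₃
          ≡⟨ cong (_+ A₃) (∑-+ (choose (suc j) xs) (λ ys → ∑ (deletions ys) f′) f) ⟩
        A₁ + Q + A₃
          ≡⟨ xy∙z≈xz∙y A₁ Q A₃ ⟩
        A₁ + A₃ + Q
          ∎

  -- A k-subset of xs survives in exactly (length xs − k) of the deletions of xs.
  ∑-deletions-choose : ∀ k (xs : List A) (f : List A → ℕ) →
    ∑[ ys ← deletions xs ] ∑ (choose k ys) f + k * ∑ (choose k xs) f
      ≡ length xs * ∑ (choose k xs) f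
  ∑-deletions-choose zero xs f = begin
    ∑[ _ ← deletions xs ] c + 0 ≡⟨ +-identityʳ _ ⟩
    ∑[ _ ← deletions xs ] c     ≡⟨ ∑-const c (deletions xs) ⟩
    c * length (deletions xs)   ≡⟨ cong (c *_) (length-deletions xs) ⟩
    c * length xs               ≡⟨ *-comm c (length xs) ⟩
    length xs * c               ∎
    where
      open ≡-Reasoning
      c = f [] + 0
  ∑-deletions-choose (suc k) []       f = *-zeroʳ (suc k)
  ∑-deletions-choose (suc j) (x ∷ xs) f = begin
    ∑[ ys ← deletions (x ∷ xs) ] ∑ (choose (suc j) ys) f
      + suc j * ∑ (choose (suc j) (x ∷ xs)) f
      ≡⟨ cong₂ (λ u v → u + suc j * v) outer (∑-choose-∷ j x xs f) ⟩
    B₁ + B₃ + Q + suc j * (P + Q)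
      ≡⟨ double-counting-step (length xs) j
           (∑-deletions-choose j xs f′) (∑-deletions-choose (suc j) xs f) ⟩
    suc (length xs) * (P + Q)
      ≡⟨ cong (suc (length xs) *_) (∑-choose-∷ j x xs f) ⟨
    suc (length xs) * ∑ (choose (suc j) (x ∷ xs)) f
      ∎
    where
      open ≡-Reasoning
      f′ = λ ys → f (x ∷ ys)
      B₁ = ∑[ ys ← deletions xs ] ∑ (choose j ys) f′
      B₃ = ∑[ ys ← deletions xs ] ∑ (choose (suc j) ys) f
      P  = ∑ (choose j xs) f′
      Q  = ∑ (choose (suc j) xs) f
      outer : ∑[ ys ← deletions (x ∷ xs) ] ∑ (choose (suc j) ys) f ≡ B₁ + B₃ + Q
      outer = begin
        ∑[ ys ← deletions (x ∷ xs) ] ∑ (choose (suc j) ys) f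
          ≡⟨ ∑-deletions-∷ x xs (λ ys → ∑ (choose (suc j) ys) f) ⟩
        ∑[ ys ← deletions xs ] ∑ (choose (suc j) (x ∷ ys)) f + Q
          ≡⟨ cong (_+ Q) (∑-cong (λ ys → ∑-choose-∷ j x ys f) (deletions xs)) ⟩
        ∑[ ys ← deletions xs ] (∑ (choose j ys) f′ + ∑ (choose (suc j) ys) f) + Q
          ≡⟨ cong (_+ Q) (∑-+ (deletions xs) (λ ys → ∑ (choose j ys) f′)
                                              (λ ys → ∑ (choose (suc j) ys) f)) ⟩
        B₁ + B₃ + Q
          ∎

  nCk>0 : ∀ {n k} → k ≤ n → n C k > 0
  nCk>0 {n}     {zero}  _         = s≤s z≤n
  nCk>0 {suc n} {suc k} (s≤s k≤n) =
    <-≤-trans (nCk>0 k≤n) (subst (n C k ≤_) (nCk+nC[k+1]≡[n+1]C[k+1] n k) (m≤m+n _ _))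

  -- Count pairs (Y, Z) with Z a deletion of a (k+1)-subset Y of an n-element list.
  [k+1]*nC[k+1]+k*nCk≡n*nCk : ∀ n k → suc k * (n C suc k) + k * (n C k) ≡ n * (n C k)
  [k+1]*nC[k+1]+k*nCk≡n*nCk n k = begin
    suc k * (n C suc k) + k * (n C k)
      ≡⟨ cong₂ (λ u v → u + k * v) (sym pairs) (sym (subsets k)) ⟩
    ∑[ ys ← choose (suc k) xs ] ∑[ _ ← deletions ys ] 1 + k * ∑[ _ ← choose k xs ] 1
      ≡⟨ ∑-choose-deletions k xs (λ _ → 1) ⟩
    length xs * ∑[ _ ← choose k xs ] 1
      ≡⟨ cong₂ _*_ (length-replicate n) (subsets k) ⟩
    n * (n C k)
      ∎
    where
      open ≡-Reasoning
      xs = replicate n tt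
      |choose| : ∀ j → length (choose j xs) ≡ n C j
      |choose| j = trans (length-choose j xs) (cong (_C j) (length-replicate n))
      subsets : ∀ j → ∑[ _ ← choose j xs ] 1 ≡ n C j
      subsets j = trans (∑-1 (choose j xs)) (|choose| j)
      |deletions| : ∀ ys → length ys ≡ suc k → ∑[ _ ← deletions ys ] 1 ≡ suc k
      |deletions| ys |ys|≡k+1 = trans (∑-1 (deletions ys)) (trans (length-deletions ys) |ys|≡k+1)
      pairs : ∑[ ys ← choose (suc k) xs ] ∑[ _ ← deletions ys ] 1 ≡ suc k * (n C suc k)
      pairs = begin
        ∑[ ys ← choose (suc k) xs ] ∑[ _ ← deletions ys ] 1
          ≡⟨ ∑-cong-All (choose (suc k) xs)
               (All.map (λ {ys} → |deletions| ys) (choose-length (suc k) xs)) ⟩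
        ∑[ _ ← choose (suc k) xs ] suc k
          ≡⟨ ∑-const (suc k) (choose (suc k) xs) ⟩
        suc k * length (choose (suc k) xs)
          ≡⟨ cong (suc k *_) (|choose| (suc k)) ⟩
        suc k * (n C suc k)
          ∎

  2*[m+1]C2≡[m+1]*m : ∀ m → 2 * (suc m C 2) ≡ suc m * m
  2*[m+1]C2≡[m+1]*m m = +-cancelʳ-≡ n (2 * (n C 2)) (n * m) (begin
    2 * (n C 2) + n           ≡⟨ cong (2 * (n C 2) +_) (trans (*-identityˡ (n C 1)) (nC1≡n n)) ⟨
    2 * (n C 2) + 1 * (n C 1) ≡⟨ [k+1]*nC[k+1]+k*nCk≡n*nCk n 1 ⟩
    n * (n C 1)               ≡⟨ cong (n *_) (nC1≡n n) ⟩
    n * n                     ≡⟨ *-suc n m ⟩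
    n + n * m                 ≡⟨ +-comm n (n * m) ⟩
    n * m + n                 ∎)
    where
      open ≡-Reasoning
      n = suc m

  NCn*T≡NC[n+1]*[n+1]*E : ∀ N n E T →
    T + n * E ≡ N * E → (N C n) * T ≡ (N C suc n) * (suc n * E)
  NCn*T≡NC[n+1]*[n+1]*E N n E T T+nE≡NE =
    +-cancelʳ-≡ (n * a * E) (a * T) (a′ * (suc n * E)) (begin
    a * T + n * a * E            ≡⟨ factor a T n E ⟩
    a * (T + n * E)              ≡⟨ cong (a *_) T+nE≡NE ⟩
    a * (N * E)                  ≡⟨ *-assoc a N E ⟨
    a * N * E                    ≡⟨ cong (_* E) absorption ⟨
    (suc n * a′ + n * a) * E     ≡⟨ *-distribʳ-+ E (suc n * a′) (n * a) ⟩
    suc n * a′ * E + n * a * E   ≡⟨ cong (_+ n * a * E) (regroup (suc n) a′ E) ⟩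
    a′ * (suc n * E) + n * a * E ∎)
    where
      open ≡-Reasoning
      a  = N C n
      a′ = N C suc n
      absorption : suc n * a′ + n * a ≡ a * N
      absorption = trans ([k+1]*nC[k+1]+k*nCk≡n*nCk N n) (*-comm N a)
      factor : ∀ a T n E → a * T + n * a * E ≡ a * (T + n * E)
      factor = solve-∀
      regroup : ∀ x y z → x * y * z ≡ y * (x * z)
      regroup = solve-∀

  length-cube : ∀ d → length (cube d) ≡ 2 ^ d
  length-cube zero    = refl
  length-cube (suc d) = begin
    length (map (1ℚ ∷_) (cube d) ++ map ((- 1ℚ) ∷_) (cube d))
      ≡⟨ length-++ (map (1ℚ ∷_) (cube d)) ⟩
    length (map (1ℚ ∷_) (cube d)) + length (map ((- 1ℚ) ∷_) (cube d))
      ≡⟨ cong₂ _+_ (length-map (1ℚ ∷_) (cube d)) (length-map ((- 1ℚ) ∷_) (cube d)) ⟩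
    length (cube d) + length (cube d)
      ≡⟨ cong (λ m → m + m) (length-cube d) ⟩
    2 ^ d + 2 ^ d
      ≡⟨ cong (2 ^ d +_) (+-identityʳ (2 ^ d)) ⟨
    2 ^ suc d
      ∎
    where open ≡-Reasoning

  outcomes>0 : ∀ d {n} → 2 ≤ n → n ≤ 2 ^ d → outcomes d n > 0
  outcomes>0 d 2≤n n≤2^d = *-mono-< (nCk>0 n≤2^d) (nCk>0 2≤n)

  cross-multiplied-< : ∀ N m E E′ T → N C suc m > 0 →
    T + suc m * E ≡ N * E → suc (suc m) * E′ < T + 2 * E′ →
    E′ * ((N C suc m) * (suc m C 2)) < E * ((N C suc (suc m)) * (suc (suc m) C 2))
  cross-multiplied-< N m E E′ T a>0 T+nE≡NE [n+1]E′<T+2E′ =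
    *-cancelˡ-< 2 _ _ (begin-strict
    2 * (E′ * (a * b))     ≡⟨ *-middle E′ a b ⟩
    E′ * a * (2 * b)       ≡⟨ cong (E′ * a *_) (2*[m+1]C2≡[m+1]*m m) ⟩
    E′ * a * (n * m)       ≡⟨ shuffle E′ a n m ⟩
    n * (a * (m * E′))     <⟨ *-monoʳ-< n (*-monoʳ-< a mE′<T) ⟩
    n * (a * T)            ≡⟨ cong (n *_) (NCn*T≡NC[n+1]*[n+1]*E N n E T T+nE≡NE) ⟩
    n * (a′ * (suc n * E)) ≡⟨ shuffle E a′ n (suc n) ⟨
    E * a′ * (n * suc n)   ≡⟨ cong (E * a′ *_) (trans (2*[m+1]C2≡[m+1]*m n) (*-comm (suc n) n)) ⟨
    E * a′ * (2 * b′)      ≡⟨ *-middle E a′ b′ ⟨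
    2 * (E * (a′ * b′))    ∎)
    where
      open ≤-Reasoning
      n  = suc m
      a  = N C n
      a′ = N C suc n
      b  = n C 2
      b′ = suc n C 2
      instance
        a≢0 : NonZero a
        a≢0 = >-nonZero a>0
      split : ∀ m E′ → suc (suc m) * E′ ≡ m * E′ + 2 * E′
      split = solve-∀
      mE′<T : m * E′ < T
      mE′<T = +-cancelʳ-< (2 * E′) (m * E′) T
                (subst (_< T + 2 * E′) (split m E′) [n+1]E′<T+2E′)
      *-middle : ∀ x y z → 2 * (x * (y * z)) ≡ x * y * (2 * z)
      *-middle = solve-∀
      shuffle : ∀ x y u v → x * y * (u * v) ≡ u * (y * (v * x))
      shuffle = solve-∀

  record EdgeCreatingDeletion (d n : ℕ) : Set where
    field
      Y Z    : List (Point d)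
      v w    : Point d
      Y∈     : Y ∈ choose (suc n) (cube d)
      Z∈     : Z ∈ deletions Y
      vw∈    : (v ∷ w ∷ []) ∈ choose 2 Z
      ¬edgeY : ¬ IsEdge Y v w
      edgeZ  : IsEdge Z v w

  IsEdge-anti-mono : ∀ {d} {Y Z : List (Point d)} {v w} → Z ⊆ Y → IsEdge Y v w → IsEdge Z v w
  IsEdge-anti-mono Z⊆Y (a , b , av≡b , aw≡b , valid) =
    a , b , av≡b , aw≡b , All.anti-mono Z⊆Y valid

  module _ {d : ℕ} (dec : EdgeDecider d) where

    edgeIndicator-anti-mono : ∀ {Y Z} → Z ⊆ Y → ∀ p →
      edgeIndicator dec Y p ≤ edgeIndicator dec Z p
    edgeIndicator-anti-mono         Z⊆Y []              = z≤n
    edgeIndicator-anti-mono         Z⊆Y (v ∷ [])        = z≤n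
    edgeIndicator-anti-mono {Y} {Z} Z⊆Y (v ∷ w ∷ [])    with dec Y v w | dec Z v w
    ... | yes _     | yes _     = ≤-refl
    ... | yes edgeY | no ¬edgeZ = contradiction (IsEdge-anti-mono Z⊆Y edgeY) ¬edgeZ
    ... | no _      | _         = z≤n
    edgeIndicator-anti-mono         Z⊆Y (v ∷ w ∷ _ ∷ _) = z≤n

    edgeIndicator-< : ∀ {Y Z v w} → ¬ IsEdge Y v w → IsEdge Z v w →
      edgeIndicator dec Y (v ∷ w ∷ []) < edgeIndicator dec Z (v ∷ w ∷ [])
    edgeIndicator-< {Y} {Z} {v} {w} ¬edgeY edgeZ with dec Y v w | dec Z v w
    ... | yes edgeY | _         = contradiction edgeY ¬edgeY
    ... | no _      | yes _     = s≤s z≤n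
    ... | no _      | no ¬edgeZ = contradiction edgeZ ¬edgeZ

    edges : List (Point d) → ℕ
    edges X = ∑[ p ← choose 2 X ] edgeIndicator dec X p

    edgeIndicators-⊆ : ∀ {Y Z} → Z ⊆ Y →
      All (λ p → edgeIndicator dec Y p ≤ edgeIndicator dec Z p) (choose 2 Z)
    edgeIndicators-⊆ Z⊆Y = All.tabulate (λ {p} _ → edgeIndicator-anti-mono Z⊆Y p)

    edges-deletions-≤ : ∀ Y →
      All (λ Z → ∑ (choose 2 Z) (edgeIndicator dec Y) ≤ edges Z) (deletions Y)
    edges-deletions-≤ Y =
      All.map (λ {Z} (Z⊆Y : Z ⊆ Y) → ∑-mono-≤ (choose 2 Z) (edgeIndicators-⊆ Z⊆Y)) (deletions-⊆ Y)

    length*edges≡ : ∀ Y →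
      length Y * edges Y ≡ ∑[ Z ← deletions Y ] ∑ (choose 2 Z) (edgeIndicator dec Y) + 2 * edges Y
    length*edges≡ Y = sym (∑-deletions-choose 2 Y (edgeIndicator dec Y))

    length*edges≤ : ∀ Y → length Y * edges Y ≤ ∑ (deletions Y) edges + 2 * edges Y
    length*edges≤ Y = begin
      length Y * edges Y
        ≡⟨ length*edges≡ Y ⟩
      ∑[ Z ← deletions Y ] ∑ (choose 2 Z) (edgeIndicator dec Y) + 2 * edges Y
        ≤⟨ +-monoˡ-≤ (2 * edges Y) (∑-mono-≤ (deletions Y) (edges-deletions-≤ Y)) ⟩
      ∑ (deletions Y) edges + 2 * edges Y
        ∎
      where open ≤-Reasoning

    length*edges< : ∀ Y {Z v w} → Z ∈ deletions Y → (v ∷ w ∷ []) ∈ choose 2 Z →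
      ¬ IsEdge Y v w → IsEdge Z v w → length Y * edges Y < ∑ (deletions Y) edges + 2 * edges Y
    length*edges< Y {Z} Z∈ vw∈ ¬edgeY edgeZ = begin-strict
      length Y * edges Y
        ≡⟨ length*edges≡ Y ⟩
      ∑[ Z ← deletions Y ] ∑ (choose 2 Z) (edgeIndicator dec Y) + 2 * edges Y
        <⟨ +-monoˡ-< (2 * edges Y) (∑-mono-< (deletions Y) (edges-deletions-≤ Y) Z∈ Z-<) ⟩
      ∑ (deletions Y) edges + 2 * edges Y
        ∎
      where
        open ≤-Reasoning
        Z-< : ∑ (choose 2 Z) (edgeIndicator dec Y) < edges Z
        Z-< = ∑-mono-< (choose 2 Z) (edgeIndicators-⊆ (All.lookup (deletions-⊆ Y) Z∈)) vw∈
                (edgeIndicator-< ¬edgeY edgeZ)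

    deletionEdgeCount : ℕ → ℕ
    deletionEdgeCount n = ∑[ Y ← choose (suc n) (cube d) ] ∑ (deletions Y) edges

    deletionEdgeCount+n*edgeCount : ∀ n →
      deletionEdgeCount n + n * edgeCount d dec n ≡ 2 ^ d * edgeCount d dec n
    deletionEdgeCount+n*edgeCount n =
      trans (∑-choose-deletions n (cube d) edges) (cong (_* edgeCount d dec n) (length-cube d))

    [n+1]*edgeCount<deletionEdgeCount : ∀ {n} → EdgeCreatingDeletion d n →
      suc n * edgeCount d dec (suc n) < deletionEdgeCount n + 2 * edgeCount d dec (suc n)
    [n+1]*edgeCount<deletionEdgeCount {n} witness = begin-strict
      suc n * edgeCount d dec (suc n)
        ≡⟨ ∑-*ˡ (suc n) Ys edges ⟨
      ∑[ X ← Ys ] (suc n * edges X)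
        ≡⟨ ∑-cong-All Ys sizes ⟩
      ∑[ X ← Ys ] (length X * edges X)
        <⟨ ∑-mono-< Ys (All.tabulate (λ {X} _ → length*edges≤ X)) Y∈
                    (length*edges< Y Z∈ vw∈ ¬edgeY edgeZ) ⟩
      ∑[ X ← Ys ] (∑ (deletions X) edges + 2 * edges X)
        ≡⟨ ∑-+ Ys (λ X → ∑ (deletions X) edges) (λ X → 2 * edges X) ⟩
      deletionEdgeCount n + ∑[ X ← Ys ] (2 * edges X)
        ≡⟨ cong (deletionEdgeCount n +_) (∑-*ˡ 2 Ys edges) ⟩
      deletionEdgeCount n + 2 * edgeCount d dec (suc n)
        ∎
      where
        open ≤-Reasoning
        open EdgeCreatingDeletion witness
        Ys = choose (suc n) (cube d)
        sizes : All (λ X → suc n * edges X ≡ length X * edges X) Ys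
        sizes = All.map (λ {X} |X|≡n+1 → cong (_* edges X) (sym |X|≡n+1)) (choose-length (suc n) (cube d))

open Counting

module SquareFace where

  open import Data.Nat using (ℕ; zero; suc)
  open import Data.Integer as ℤ using ()
  open import Data.Rational using (ℚ; 0ℚ; 1ℚ; -_; _+_; _*_; _/_; _<_; _≤_)
  open import Data.Rational.Properties
    using (_<?_; _≤?_; ≤-trans; ≤-reflexive; <⇒≤; <-irrefl; +-assoc; +-mono-≤; +-monoʳ-≤;
           +-monoˡ-<; +-monoʳ-<; +-mono-<-≤; +-0-commutativeMonoid; module ≤-Reasoning)
  open import Data.Rational.Solver using (module +-*-Solver)
  open import Algebra.Bundles using (CommutativeMonoid)
  open import Algebra.Properties.CommutativeSemigroup
    (CommutativeMonoid.commutativeSemigroup +-0-commutativeMonoid)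
    using (x∙yz≈xz∙y) renaming (interchange to +-interchange)
  open import Data.Vec as Vec using (_∷_; [])
  open import Data.List using (List; []; _∷_; map; _++_)
  open import Data.List.Relation.Unary.All as All using (All; _∷_; [])
  open import Data.List.Relation.Unary.All.Properties as All using ()
  open import Data.Product using (_×_; _,_)
  open import Data.Sum using (_⊎_; inj₁; inj₂)
  open import Function using (_∘_)
  open import Relation.Nullary using (¬_; contradiction)
  open import Relation.Nullary.Decidable using (True; toWitness)
  open import Relation.Binary.PropositionalEquality
    using (_≡_; _≢_; refl; sym; trans; cong; cong₂; module ≡-Reasoning)

  private
    2ℚ 3ℚ : ℚ
    2ℚ = ℤ.+ 2 / 1
    3ℚ = ℤ.+ 3 / 1

    decide-< : ∀ p q → {True (p <? q)} → p < q
    decide-< p q {p<q} = toWitness p<q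

    decide-≤ : ∀ p q → {True (p ≤? q)} → p ≤ q
    decide-≤ p q {p≤q} = toWitness p≤q

  corner : (e : ℕ) → ℚ → ℚ → Point (suc (suc e))
  corner zero    s t = s ∷ t ∷ []
  corner (suc e) s t = 1ℚ ∷ corner e s t

  v₊₊ v₊₋ v₋₊ v₋₋ : (e : ℕ) → Point (suc (suc e))
  v₊₊ e = corner e 1ℚ 1ℚ
  v₊₋ e = corner e 1ℚ (- 1ℚ)
  v₋₊ e = corner e (- 1ℚ) 1ℚ
  v₋₋ e = corner e (- 1ℚ) (- 1ℚ)

  -- The hyperplane ⟨normal e, x⟩ = level e passes through v₊₊ and v₋₋, v₊₋ lies above it
  -- (at level e + 2), and every other cube vertex strictly below.
  normal : (e : ℕ) → Point (suc (suc e))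
  normal zero    = 1ℚ ∷ - 1ℚ ∷ []
  normal (suc e) = 3ℚ ∷ normal e

  level : ℕ → ℚ
  level e = dot (normal e) (v₊₊ e)

  dot-normal-v₋₋ : ∀ e → dot (normal e) (v₋₋ e) ≡ level e
  dot-normal-v₋₋ zero    = refl
  dot-normal-v₋₋ (suc e) = cong ((3ℚ * 1ℚ) +_) (dot-normal-v₋₋ e)

  dot-normal-v₋₊ : ∀ e → dot (normal e) (v₋₊ e) < level e
  dot-normal-v₋₊ zero    = decide-< _ _
  dot-normal-v₋₊ (suc e) = +-monoʳ-< (3ℚ * 1ℚ) (dot-normal-v₋₊ e)

  cube-below : ∀ e → All (λ x → dot (normal e) x ≤ level e + 2ℚ) (cube (suc (suc e)))
  cube-below zero    = decide-≤ _ _ ∷ decide-≤ _ _ ∷ decide-≤ _ _ ∷ decide-≤ _ _ ∷ []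
  cube-below (suc e) =
    All.++⁺ (All.map⁺ (All.map (step (≤-reflexive refl)) (cube-below e)))
            (All.map⁺ (All.map (step (decide-≤ (3ℚ * - 1ℚ) (3ℚ * 1ℚ))) (cube-below e)))
    where
      step : ∀ {c x} → c ≤ 3ℚ * 1ℚ → dot (normal e) x ≤ level e + 2ℚ →
             c + dot (normal e) x ≤ 3ℚ * 1ℚ + level e + 2ℚ
      step c≤3 x≤ = ≤-trans (+-mono-≤ c≤3 x≤) (≤-reflexive (sym (+-assoc (3ℚ * 1ℚ) (level e) 2ℚ)))

  others : (e : ℕ) → List (Point (suc (suc e)))
  others zero    = []
  others (suc e) = map (1ℚ ∷_) (others e) ++ map ((- 1ℚ) ∷_) (cube (suc (suc e)))

  cube≡square++others : ∀ e → cube (suc (suc e)) ≡ v₊₊ e ∷ v₊₋ e ∷ v₋₊ e ∷ v₋₋ e ∷ others e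
  cube≡square++others zero    = refl
  cube≡square++others (suc e) =
    cong (λ c → map (1ℚ ∷_) c ++ map ((- 1ℚ) ∷_) (cube (suc (suc e)))) (cube≡square++others e)

  -- The coefficient 3 exceeds the slack 2 of cube-below, so the half of the next cube with
  -- first coordinate −1 lies strictly below the hyperplane.
  others-below : ∀ e → All (λ x → dot (normal e) x < level e) (others e)
  others-below zero    = []
  others-below (suc e) =
    All.++⁺ (All.map⁺ (All.map (+-monoʳ-< (3ℚ * 1ℚ)) (others-below e)))
            (All.map⁺ (All.map step₋ (cube-below e)))
    where
      step₋ : ∀ {x} → dot (normal e) x ≤ level e + 2ℚ →
              3ℚ * - 1ℚ + dot (normal e) x < 3ℚ * 1ℚ + level e
      step₋ {x} x≤ = begin-strict
        3ℚ * - 1ℚ + dot (normal e) x ≤⟨ +-monoʳ-≤ (3ℚ * - 1ℚ) x≤ ⟩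
        3ℚ * - 1ℚ + (level e + 2ℚ)   ≡⟨ x∙yz≈xz∙y (3ℚ * - 1ℚ) (level e) 2ℚ ⟩
        3ℚ * - 1ℚ + 2ℚ + level e     <⟨ +-monoˡ-< (level e) (decide-< (3ℚ * - 1ℚ + 2ℚ) (3ℚ * 1ℚ)) ⟩
        3ℚ * 1ℚ + level e            ∎
        where open ≤-Reasoning

  corner-injective : ∀ e {s t s′ t′} → corner e s t ≡ corner e s′ t′ → s ≡ s′ × t ≡ t′
  corner-injective zero    refl = refl , refl
  corner-injective (suc e) eq   = corner-injective e (cong Vec.tail eq)

  dot-parallelogram : ∀ e (a : Point (suc (suc e))) s t s′ t′ →
    dot a (corner e s t) + dot a (corner e s′ t′) ≡ dot a (corner e s t′) + dot a (corner e s′ t)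
  dot-parallelogram zero (α ∷ β ∷ []) s t s′ t′ =
    solve 6 (λ α β s t s′ t′ → (α :* s :+ (β :* t :+ con 0ℚ)) :+ (α :* s′ :+ (β :* t′ :+ con 0ℚ))
                            := (α :* s :+ (β :* t′ :+ con 0ℚ)) :+ (α :* s′ :+ (β :* t :+ con 0ℚ)))
            refl α β s t s′ t′
    where open +-*-Solver
  dot-parallelogram (suc e) (α ∷ a) s t s′ t′ = begin
    (α * 1ℚ + dot a (corner e s t)) + (α * 1ℚ + dot a (corner e s′ t′))
      ≡⟨ +-interchange (α * 1ℚ) _ (α * 1ℚ) _ ⟩
    (α * 1ℚ + α * 1ℚ) + (dot a (corner e s t) + dot a (corner e s′ t′))
      ≡⟨ cong (α * 1ℚ + α * 1ℚ +_) (dot-parallelogram e a s t s′ t′) ⟩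
    (α * 1ℚ + α * 1ℚ) + (dot a (corner e s t′) + dot a (corner e s′ t))
      ≡⟨ +-interchange (α * 1ℚ) _ (α * 1ℚ) _ ⟨
    (α * 1ℚ + dot a (corner e s t′)) + (α * 1ℚ + dot a (corner e s′ t))
      ∎
    where open ≡-Reasoning

  off-diagonal : ∀ e {s t} → s ≢ t → ∀ {P : Set} →
    corner e s t ≡ v₊₊ e ⊎ (corner e s t ≡ v₋₋ e ⊎ P) → P
  off-diagonal e s≢t (inj₁ eq)        with corner-injective e eq
  ... | s≡1 , t≡1   = contradiction (trans s≡1 (sym t≡1)) s≢t
  off-diagonal e s≢t (inj₂ (inj₁ eq)) with corner-injective e eq
  ... | s≡-1 , t≡-1 = contradiction (trans s≡-1 (sym t≡-1)) s≢t
  off-diagonal e s≢t (inj₂ (inj₂ p))  = p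

  1≢-1 : 1ℚ ≢ - 1ℚ
  1≢-1 ()

  diagonal-not-edge : ∀ e R → ¬ IsEdge (v₊₊ e ∷ v₊₋ e ∷ v₋₊ e ∷ v₋₋ e ∷ R) (v₊₊ e) (v₋₋ e)
  diagonal-not-edge e R (a , b , a·v₊₊≡b , a·v₋₋≡b , _ ∷ v₊₋-valid ∷ v₋₊-valid ∷ _) =
    <-irrefl refl (begin-strict
      b + b                         ≡⟨ cong₂ _+_ a·v₊₊≡b a·v₋₋≡b ⟨
      dot a (v₊₊ e) + dot a (v₋₋ e) ≡⟨ dot-parallelogram e a 1ℚ 1ℚ (- 1ℚ) (- 1ℚ) ⟩
      dot a (v₊₋ e) + dot a (v₋₊ e) <⟨ +-mono-<-≤ (off-diagonal e 1≢-1 v₊₋-valid)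
                                                  (<⇒≤ (off-diagonal e (1≢-1 ∘ sym) v₋₊-valid)) ⟩
      b + b                         ∎)
    where open ≤-Reasoning

  diagonal-edge : ∀ e R → All (λ x → dot (normal e) x < level e) R →
                  IsEdge (v₊₊ e ∷ v₋₊ e ∷ v₋₋ e ∷ R) (v₊₊ e) (v₋₋ e)
  diagonal-edge e R R-below = normal e , level e , refl , dot-normal-v₋₋ e ,
    inj₁ refl ∷ inj₂ (inj₂ (dot-normal-v₋₊ e)) ∷ inj₂ (inj₁ refl) ∷ All.map (inj₂ ∘ inj₂) R-below

open SquareFace

open import Data.Nat as ℕ using (ℕ; zero; suc; _+_; _*_; _≤_; _^_; _∸_; z≤n; s≤s)
open import Data.Nat.Properties using (≤-trans; n≤1+n; +-comm; +-cancelˡ-≤; m≤o∸n⇒m+n≤o; m^n>0)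
open import Data.Integer as ℤ using (+_; +<+)
open import Data.Integer.Properties using (pos-*)
open import Data.Rational using (_<_; _/_)
open import Data.Rational.Properties using (toℚᵘ-cancel-<; toℚᵘ-fromℚᵘ)
open import Data.Rational.Unnormalised using (mkℚᵘ; *<*)
open import Data.Rational.Unnormalised.Properties using (<-resp-≃; ≃-sym)
open import Data.List using ([]; _∷_; _++_; take; length)
open import Data.List.Relation.Unary.All.Properties using (take⁺)
open import Data.List.Relation.Unary.Any using (here; there)
open import Data.List.Membership.Propositional using (_∈_)
open import Data.Product using (proj₁; proj₂)
open import Relation.Binary.PropositionalEquality using (_≡_; refl; sym; trans; cong; subst; subst₂)

square-edgeCreatingDeletion : ∀ e r → 4 + r ≤ 2 ^ (2 + e) → EdgeCreatingDeletion (2 + e) (3 + r)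
square-edgeCreatingDeletion e r 4+r≤2^d = record
  { Y      = square ++ R
  ; Z      = v₊₊ e ∷ v₋₊ e ∷ v₋₋ e ∷ R
  ; v      = v₊₊ e
  ; w      = v₋₋ e
  ; Y∈     = subst (λ c → square ++ R ∈ choose (4 + r) c) (sym (cube≡square++others e))
               (take∈choose (4 + r) (square ++ others e) (s≤s (s≤s (s≤s (s≤s r≤|others|)))))
  ; Z∈     = x∷xs∈deletions[x∷y∷xs] (v₊₊ e) (v₊₋ e) (v₋₊ e ∷ v₋₋ e ∷ R)
  ; vw∈    = there (here refl)
  ; ¬edgeY = diagonal-not-edge e R
  ; edgeZ  = diagonal-edge e R (take⁺ r (others-below e))
  }
  where
    square = v₊₊ e ∷ v₊₋ e ∷ v₋₊ e ∷ v₋₋ e ∷ []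
    R = take r (others e)
    |cube|≡4+|others| : 2 ^ (2 + e) ≡ 4 + length (others e)
    |cube|≡4+|others| = trans (sym (length-cube (2 + e))) (cong length (cube≡square++others e))
    r≤|others| : r ≤ length (others e)
    r≤|others| = +-cancelˡ-≤ 4 r (length (others e)) (subst (4 + r ≤_) |cube|≡4+|others| 4+r≤2^d)

+a/[1+b]<+c/[1+d] : ∀ a b c d → a * suc d ℕ.< c * suc b → (+ a) / suc b < (+ c) / suc d
+a/[1+b]<+c/[1+d] a b c d ad<cb = toℚᵘ-cancel-<
  (proj₁ <-resp-≃ (≃-sym (toℚᵘ-fromℚᵘ (mkℚᵘ (+ c) d)))
    (proj₂ <-resp-≃ (≃-sym (toℚᵘ-fromℚᵘ (mkℚᵘ (+ a) b)))
      (*<* (subst₂ ℤ._<_ (pos-* a (suc d)) (pos-* c (suc b)) (+<+ ad<cb)))))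

-- The positivity hypotheses rule out the junk value π = 0 (the zero cases of the with are absurd).
π-< : ∀ {d} (dec : EdgeDecider d) m n → outcomes d m ℕ.> 0 → outcomes d n ℕ.> 0 →
      edgeCount d dec m * outcomes d n ℕ.< edgeCount d dec n * outcomes d m →
      π d dec m < π d dec n
π-< {d} dec m n _ _ cross-< with outcomes d m | outcomes d n
... | suc k | suc l = +a/[1+b]<+c/[1+d] (edgeCount d dec m) k (edgeCount d dec n) l cross-<

proposition3 : (d : ℕ) (dec : EdgeDecider d) (n : ℕ) →
               3 ≤ n → n ≤ 2 ^ d ∸ 1 →
               π d dec (suc n) < π d dec n
proposition3 zero          dec (suc n)               _                   ()
proposition3 (suc zero)    dec (suc zero)            (s≤s ())            _
proposition3 (suc zero)    dec (suc (suc n))         _                   (s≤s ())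
proposition3 (suc (suc e)) dec n@(suc (suc (suc r))) (s≤s (s≤s (s≤s _))) n≤2^d∸1 =
  π-< dec (suc n) n (outcomes>0 d 2≤n+1 n+1≤2^d) (outcomes>0 d 2≤n n≤2^d)
    (cross-multiplied-< (2 ^ d) (2 + r) E E′ (deletionEdgeCount dec n) (nCk>0 n≤2^d)
      (deletionEdgeCount+n*edgeCount dec n)
      ([n+1]*edgeCount<deletionEdgeCount dec (square-edgeCreatingDeletion e r n+1≤2^d)))
  where
    d  = 2 + e
    E  = edgeCount d dec n
    E′ = edgeCount d dec (suc n)
    2≤n : 2 ≤ n
    2≤n = s≤s (s≤s z≤n)
    2≤n+1 : 2 ≤ suc n
    2≤n+1 = s≤s (s≤s z≤n)
    n+1≤2^d : suc n ≤ 2 ^ d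
    n+1≤2^d = subst (_≤ 2 ^ d) (+-comm n 1) (m≤o∸n⇒m+n≤o n (m^n>0 2 d) n≤2^d∸1)
    n≤2^d : n ≤ 2 ^ d
    n≤2^d = ≤-trans (n≤1+n n) n+1≤2^d
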